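{- Let $m\ge1$ and suppose $X\subseteq\mathbb{N}^2$ is periodic modulo $m$, i.e. there is $f:(\mathbb{Z}/m\mathbb{Z})^2\to\{0,1\}$ such that for all distinct $a,b\in\mathbb{N}$, $(a,b)\in X$ iff $f(a\bmod m,\,b\bmod m)=1$. Fix $n\ge1$ and $I\subseteq[n-1]$. For $r\in\mathbb{Z}/m\mathbb{Z}$ let $\ell_r(n)=|\{t\in[n]:t\equiv r\pmod m\}|$. Let $\mathcal{W}_{f,I}(n)$ be the set of words $w=w_1\cdots w_n$ over $\mathbb{Z}/m\mathbb{Z}$ with $|\{i:w_i=r\}|=\ell_r(n)$ for all $r$ and such that for all $i\in[n-1]$, $f(w_i,w_{i+1})=1$ iff $i\in I$. Then \[ d_X(I;n)=|\mathcal{W}_{f,I}(n)|\cdot\prod_{r\in\mathbb{Z}/m\mathbb{Z}}\ell_r(n)!. \]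
   Context: $[n]=\{1,\dots,n\}$. For $\pi=\pi_1\cdots\pi_n\in\mathfrak{S}_n$, $\mathrm{XDes}(\pi)=\{i\in[n-1]:(\pi_i,\pi_{i+1})\in X\}$, and $d_X(I;n)$ is the number of $\pi\in\mathfrak{S}_n$ with $\mathrm{XDes}(\pi)=I$. -}

module Defs where

open import Data.Bool using (Bool; true; false; _∧_; if_then_else_)
open import Data.Nat using (ℕ; zero; suc; _+_; _*_; NonZero)
open import Data.Nat.DivMod using (_mod_)
open import Data.Nat using (_!)
open import Data.Fin using (Fin; zero; suc; toℕ; inject₁; _≟_)
open import Data.Vec using (Vec; []; _∷_; lookup; tabulate; toList)
open import Data.List using (List; []; _∷_; map; concatMap; upTo; allFin)
open import Data.Bool.ListAction using (all; any)
open import Relation.Nullary.Decidable using (⌊_⌋)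

count : {A : Set} → (A → Bool) → List A → ℕ
count p []       = 0
count p (x ∷ xs) = if p x then suc (count p xs) else count p xs

allVecs : {A : Set} → List A → (n : ℕ) → List (Vec A n)
allVecs xs zero    = [] ∷ []
allVecs xs (suc n) = concatMap (λ x → map (x ∷_) (allVecs xs n)) xs

prodFin : (m : ℕ) → (Fin m → ℕ) → ℕ
prodFin zero    g = 1
prodFin (suc m) g = g zero * prodFin m (λ r → g (suc r))

-- a word v : Vec (Fin n) n (one-line notation with values shifted by 1)
-- is a permutation iff every j : Fin n occurs in it
isPerm : (n : ℕ) → Vec (Fin n) n → Bool
isPerm n v = all (λ j → any (λ x → ⌊ x ≟ j ⌋) (toList v)) (allFin n)

-- all permutations of [n], π_i = toℕ (lookup v (i-1)) + 1
-- (enumerated as words over Fin n that are bijective)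
-- value π_i for 0-based position i
val : {n : ℕ} → Vec (Fin n) n → Fin n → ℕ
val v i = suc (toℕ (lookup v i))

_==ᵇ_ : Bool → Bool → Bool
true  ==ᵇ b = b
false ==ᵇ true = false
false ==ᵇ false = true

eqVecBool : {k : ℕ} → Vec Bool k → Vec Bool k → Bool
eqVecBool []       []       = true
eqVecBool (a ∷ as) (b ∷ bs) = (a ==ᵇ b) ∧ eqVecBool as bs

-- X-descent set of a permutation of [suc k], as a subset of [k] = [n-1]:
-- position j : Fin k stands for i = j+1, and entry j is true iff (π_i , π_{i+1}) ∈ X
XDes : (X : ℕ → ℕ → Bool) (k : ℕ) → Vec (Fin (suc k)) (suc k) → Vec Bool k
XDes X k v = tabulate (λ j → X (val v (inject₁ j)) (val v (suc j)))

-- d_X(I; n) for n = suc k, I ⊆ [n-1] given as a characteristic vector of length k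
dX : (X : ℕ → ℕ → Bool) (k : ℕ) → Vec Bool k → ℕ
dX X k I = count (λ v → isPerm (suc k) v ∧ eqVecBool (XDes X k v) I)
                 (allVecs (allFin (suc k)) (suc k))

ell : (m : ℕ) .{{_ : NonZero m}} → ℕ → Fin m → ℕ
ell m n r = count (λ t → ⌊ (t mod m) ≟ r ⌋) (map suc (upTo n))

occ : {m n : ℕ} → Vec (Fin m) n → Fin m → ℕ
occ w r = count (λ x → ⌊ x ≟ r ⌋) (toList w)

ℕ==ᵇ : ℕ → ℕ → Bool
ℕ==ᵇ zero zero = true
ℕ==ᵇ zero (suc b) = false
ℕ==ᵇ (suc a) zero = false
ℕ==ᵇ (suc a) (suc b) = ℕ==ᵇ a b

inW : (m : ℕ) .{{_ : NonZero m}} (f : Fin m → Fin m → Bool) (k : ℕ) (I : Vec Bool k)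
      → Vec (Fin m) (suc k) → Bool
inW m f k I w =
  all (λ r → ℕ==ᵇ (occ w r) (ell m (suc k) r)) (allFin m)
  ∧ eqVecBool (tabulate (λ j → f (lookup w (inject₁ j)) (lookup w (suc j)))) I

cardW : (m : ℕ) .{{_ : NonZero m}} (f : Fin m → Fin m → Bool) (k : ℕ) (I : Vec Bool k) → ℕ
cardW m f k I = count (inW m f k I) (allVecs (allFin m) (suc k))

-- Encode a permutation π of [n] by the word of residues w = (π₁ mod m) ⋯ (πₙ mod m); its letter
-- counts are the ℓ_r(n), and since the entries of π are distinct, periodicity turns the X-descent
-- set of π into the f-descent set of w. It remains to count the permutations over a given word w:
-- more generally, the words with distinct letters from an alphabet S whose residues spell w number
-- ∏_r c_r (c_r − 1) ⋯ (c_r − occ_r(w) + 1), where c_r counts the letters of S of residue r, by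
-- induction on w. For S = [n] this is ∏_r ℓ_r(n)! when w has the content of [n], and 0 otherwise.

module Submission where

open import Defs
open import Algebra.Bundles using (CommutativeMonoid)
import Algebra.Properties.CommutativeSemigroup as CommutativeSemigroupProperties
open import Data.Bool using (Bool; true; false; _∧_; not; if_then_else_; T)
open import Data.Bool.ListAction using (all; any)
open import Data.Bool.Properties using (∧-zeroʳ; ∧-identityʳ; ∧-commutativeMonoid; T-≡; T-∧)
open import Data.Empty using (⊥-elim)
open import Data.Fin using (Fin; zero; suc; toℕ; inject₁; _≟_)
import Data.Fin.Properties as Fin
open import Data.List using (List; []; _∷_; map; concatMap; tabulate; applyUpTo; _++_; length; allFin)
import Data.List.Relation.Unary.All.Properties as All
open import Data.List.Properties using (length-tabulate; map-tabulate)
open import Data.Nat using (ℕ; zero; suc; _+_; _*_; _∸_; _≤_; _<_; z≤n; s≤s; _!; NonZero; _≤?_)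
open import Data.Nat.DivMod using (_mod_)
open import Data.Nat.Properties
  using (+-assoc; +-cancelˡ-≡; +-mono-≤; +-mono-<-≤; *-assoc; *-comm; *-zeroʳ; *-identityʳ; suc-injective;
         ≤-reflexive; +-commutativeSemigroup; m≤n⇒m<n∨m≡n; <⇒≢; m+n∸m≡n; ≰⇒>)
open import Data.Product using (_×_; _,_; proj₁; proj₂)
open import Data.Sum using (inj₁; inj₂)
open import Data.Unit using (tt)
open import Data.Vec using (Vec; []; _∷_; toList; lookup)
import Data.Vec as Vec
import Data.Vec.Properties as Vec
open import Function.Base using (_∘_)
open import Function.Bundles using (_⇔_; mk⇔; Equivalence)
open import Relation.Binary.Definitions using (DecidableEquality)
open import Relation.Binary.PropositionalEquality
open import Relation.Nullary using (yes; no; ¬_)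
open import Relation.Nullary.Decidable using (⌊_⌋; isYes≗does; toWitness; fromWitness; ⌊⌋-map′)

private variable
  A B : Set

⟦_⟧ : Bool → ℕ
⟦ true ⟧  = 1
⟦ false ⟧ = 0

sumList : (A → ℕ) → List A → ℕ
sumList g []       = 0
sumList g (x ∷ xs) = g x + sumList g xs

sumFin : (n : ℕ) → (Fin n → ℕ) → ℕ
sumFin zero    g = 0
sumFin (suc n) g = g zero + sumFin n (λ i → g (suc i))

module +-Semigroup = CommutativeSemigroupProperties +-commutativeSemigroup
module ∧-Semigroup = CommutativeSemigroupProperties (CommutativeMonoid.commutativeSemigroup ∧-commutativeMonoid)

T-injective : {a b : Bool} → T a ⇔ T b → a ≡ b
T-injective {true}  {true}  _   = refl
T-injective {true}  {false} a⇔b = ⊥-elim (Equivalence.to a⇔b tt)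
T-injective {false} {true}  a⇔b = ⊥-elim (Equivalence.from a⇔b tt)
T-injective {false} {false} _   = refl

T-not : {b : Bool} → T (not b) → ¬ T b
T-not {true} () _

if-∧ : (a b : Bool) (c : ℕ) → (if b then (if a then c else 0) else 0) ≡ (if a ∧ b then c else 0)
if-∧ true  true  c = refl
if-∧ true  false c = refl
if-∧ false true  c = refl
if-∧ false false c = refl

T-ℕ==ᵇ : ∀ a b → T (ℕ==ᵇ a b) ⇔ a ≡ b
T-ℕ==ᵇ a b = mk⇔ (to a b) (λ { refl → from a })
  where
  to : ∀ a b → T (ℕ==ᵇ a b) → a ≡ b
  to zero    zero    _ = refl
  to (suc a) (suc b) t = cong suc (to a b t)
  from : ∀ a → T (ℕ==ᵇ a a)
  from zero    = tt
  from (suc a) = from a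

T-all-allFin : ∀ {n} (p : Fin n → Bool) → T (all p (allFin n)) ⇔ (∀ i → T (p i))
T-all-allFin p = mk⇔ (λ t → All.tabulate⁻ (All.all⁺ p _ t)) (λ h → All.all⁻ p (All.tabulate⁺ h))

T-any⇔1≤count : (p : A → Bool) (xs : List A) → T (any p xs) ⇔ 1 ≤ count p xs
T-any⇔1≤count p xs = mk⇔ (to xs) (from xs)
  where
  to : ∀ xs → T (any p xs) → 1 ≤ count p xs
  to (x ∷ xs) t with p x
  ... | true  = s≤s z≤n
  ... | false = to xs t
  from : ∀ xs → 1 ≤ count p xs → T (any p xs)
  from (x ∷ xs) t with p x
  ... | true  = tt
  ... | false = from xs t

count-∷ : (p : A → Bool) (x : A) (xs : List A) → count p (x ∷ xs) ≡ ⟦ p x ⟧ + count p xs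
count-∷ p x xs with p x
... | true  = refl
... | false = refl

count-cong : {p q : A → Bool} → (∀ x → p x ≡ q x) → ∀ xs → count p xs ≡ count q xs
count-cong e []       = refl
count-cong {p = p} {q = q} e (x ∷ xs) = begin
  count p (x ∷ xs)        ≡⟨ count-∷ p x xs ⟩
  ⟦ p x ⟧ + count p xs    ≡⟨ cong₂ _+_ (cong ⟦_⟧ (e x)) (count-cong e xs) ⟩
  ⟦ q x ⟧ + count q xs    ≡⟨ count-∷ q x xs ⟨
  count q (x ∷ xs)        ∎
  where open ≡-Reasoning

count-false : (xs : List A) → count (λ _ → false) xs ≡ 0
count-false []       = refl
count-false (x ∷ xs) = count-false xs

count-∧ˡ : (b : Bool) (q : A → Bool) (xs : List A) → count (λ x → b ∧ q x) xs ≡ (if b then count q xs else 0)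
count-∧ˡ true  q xs = refl
count-∧ˡ false q xs = count-false xs

count-++ : (p : A → Bool) (xs ys : List A) → count p (xs ++ ys) ≡ count p xs + count p ys
count-++ p []       ys = refl
count-++ p (x ∷ xs) ys
  rewrite count-∷ p x (xs ++ ys) | count-∷ p x xs | count-++ p xs ys = sym (+-assoc ⟦ p x ⟧ _ _)

count-map : (p : B → Bool) (g : A → B) (xs : List A) → count p (map g xs) ≡ count (λ x → p (g x)) xs
count-map p g []       = refl
count-map p g (x ∷ xs)
  rewrite count-∷ p (g x) (map g xs) | count-∷ (λ x → p (g x)) x xs | count-map p g xs = refl

count-concatMap : (p : B → Bool) (g : A → List B) (xs : List A) →
                  count p (concatMap g xs) ≡ sumList (λ x → count p (g x)) xs
count-concatMap p g []       = refl
count-concatMap p g (x ∷ xs)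
  rewrite count-++ p (g x) (concatMap g xs) | count-concatMap p g xs = refl

count-split : (q b : A → Bool) (xs : List A) →
              count q xs ≡ count (λ y → q y ∧ b y) xs + count (λ y → q y ∧ not (b y)) xs
count-split q b []       = refl
count-split q b (y ∷ xs)
  rewrite count-∷ q y xs | count-∷ (λ y → q y ∧ b y) y xs | count-∷ (λ y → q y ∧ not (b y)) y xs
        | count-split q b xs
  = trans (cong (_+ _) (split (q y) (b y))) (+-Semigroup.interchange ⟦ q y ∧ b y ⟧ ⟦ q y ∧ not (b y) ⟧ _ _)
  where
  split : ∀ a c → ⟦ a ⟧ ≡ ⟦ a ∧ c ⟧ + ⟦ a ∧ not c ⟧
  split true  true  = refl
  split true  false = refl
  split false c     = refl

sumList-cong : {g h : A → ℕ} → (∀ x → g x ≡ h x) → ∀ xs → sumList g xs ≡ sumList h xs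
sumList-cong e []       = refl
sumList-cong e (x ∷ xs) = cong₂ _+_ (e x) (sumList-cong e xs)

sumList-+ : (g h : A → ℕ) (xs : List A) → sumList (λ x → g x + h x) xs ≡ sumList g xs + sumList h xs
sumList-+ g h []       = refl
sumList-+ g h (x ∷ xs) rewrite sumList-+ g h xs = +-Semigroup.interchange (g x) (h x) (sumList g xs) (sumList h xs)

sumList-⟦⟧ : (q : A → Bool) (xs : List A) → sumList (λ x → ⟦ q x ⟧) xs ≡ count q xs
sumList-⟦⟧ q []       = refl
sumList-⟦⟧ q (x ∷ xs) = trans (cong (⟦ q x ⟧ +_) (sumList-⟦⟧ q xs)) (sym (count-∷ q x xs))

sumList-zero : (xs : List A) → sumList (λ _ → 0) xs ≡ 0
sumList-zero []       = refl
sumList-zero (x ∷ xs) = sumList-zero xs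

sumList-if : (c : A → Bool) (g : A → ℕ) (b : ℕ) → (∀ x → T (c x) → g x ≡ b) →
             ∀ xs → sumList (λ x → if c x then g x else 0) xs ≡ count c xs * b
sumList-if c g b h []       = refl
sumList-if c g b h (x ∷ xs) with c x in eq
... | true  = cong₂ _+_ (h x (subst T (sym eq) tt)) (sumList-if c g b h xs)
... | false = sumList-if c g b h xs

count-allVecs-suc : ∀ {n} (p : Vec A (suc n) → Bool) (xs : List A) →
                    count p (allVecs xs (suc n)) ≡ sumList (λ x → count (λ v → p (x ∷ v)) (allVecs xs n)) xs
count-allVecs-suc {n = n} p xs =
  trans (count-concatMap p _ xs) (sumList-cong (λ x → count-map p (x ∷_) (allVecs xs n)) xs)

count-tabulate : ∀ {n} (p : A → Bool) (g : Fin n → A) → count p (tabulate g) ≡ sumFin n (λ i → ⟦ p (g i) ⟧)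
count-tabulate {n = zero}  p g = refl
count-tabulate {n = suc n} p g
  rewrite count-∷ p (g zero) (tabulate (λ i → g (suc i))) | count-tabulate p (λ i → g (suc i)) = refl

applyUpTo≡tabulate : (g : ℕ → A) (n : ℕ) → applyUpTo g n ≡ tabulate {n = n} (λ i → g (toℕ i))
applyUpTo≡tabulate g zero    = refl
applyUpTo≡tabulate g (suc n) = cong (g zero ∷_) (applyUpTo≡tabulate (λ i → g (suc i)) n)

sumFin-cong : ∀ n {a b : Fin n → ℕ} → (∀ i → a i ≡ b i) → sumFin n a ≡ sumFin n b
sumFin-cong zero    e = refl
sumFin-cong (suc n) e = cong₂ _+_ (e zero) (sumFin-cong n (λ i → e (suc i)))

sumFin-+ : ∀ n (a b : Fin n → ℕ) → sumFin n (λ i → a i + b i) ≡ sumFin n a + sumFin n b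
sumFin-+ zero    a b = refl
sumFin-+ (suc n) a b rewrite sumFin-+ n (λ i → a (suc i)) (λ i → b (suc i)) =
  +-Semigroup.interchange (a zero) (b zero) _ _

sumFin-const : ∀ n c → sumFin n (λ _ → c) ≡ n * c
sumFin-const zero    c = refl
sumFin-const (suc n) c = cong (c +_) (sumFin-const n c)

sumFin-indicator : ∀ {n} (x : Fin n) → sumFin n (λ r → ⟦ ⌊ x ≟ r ⌋ ⟧) ≡ 1
sumFin-indicator {suc n} zero    = cong suc (trans (sumFin-const n 0) (*-zeroʳ n))
sumFin-indicator {suc n} (suc x) =
  trans (sumFin-cong n (λ r → cong ⟦_⟧ (⌊⌋-map′ (cong suc) Fin.suc-injective (x ≟ r)))) (sumFin-indicator x)

sumFin-count : ∀ {m} (g : A → Fin m) (xs : List A) →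
               sumFin m (λ s → count (λ y → ⌊ g y ≟ s ⌋) xs) ≡ length xs
sumFin-count {m = m} g []       = trans (sumFin-const m 0) (*-zeroʳ m)
sumFin-count {m = m} g (x ∷ xs) = begin
  sumFin m (λ s → count (λ y → ⌊ g y ≟ s ⌋) (x ∷ xs))
    ≡⟨ sumFin-cong m (λ s → count-∷ (λ y → ⌊ g y ≟ s ⌋) x xs) ⟩
  sumFin m (λ s → ⟦ ⌊ g x ≟ s ⌋ ⟧ + count (λ y → ⌊ g y ≟ s ⌋) xs)
    ≡⟨ sumFin-+ m _ _ ⟩
  sumFin m (λ s → ⟦ ⌊ g x ≟ s ⌋ ⟧) + sumFin m (λ s → count (λ y → ⌊ g y ≟ s ⌋) xs)
    ≡⟨ cong₂ _+_ (sumFin-indicator (g x)) (sumFin-count g xs) ⟩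
  suc (length xs) ∎
  where open ≡-Reasoning

sumFin-mono-≤ : ∀ n {a b : Fin n → ℕ} → (∀ i → a i ≤ b i) → sumFin n a ≤ sumFin n b
sumFin-mono-≤ zero    h = z≤n
sumFin-mono-≤ (suc n) h = +-mono-≤ (h zero) (sumFin-mono-≤ n (λ i → h (suc i)))

sumFin-≤-≡⇒≡ : ∀ n {a b : Fin n → ℕ} → (∀ i → a i ≤ b i) → sumFin n a ≡ sumFin n b →
               ∀ i → a i ≡ b i
sumFin-≤-≡⇒≡ (suc n) {a} {b} a≤b Σa≡Σb = pointwise
  where
  tails≤ : sumFin n (λ i → a (suc i)) ≤ sumFin n (λ i → b (suc i))
  tails≤ = sumFin-mono-≤ n (λ i → a≤b (suc i))
  head≡ : a zero ≡ b zero
  head≡ with m≤n⇒m<n∨m≡n (a≤b zero)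
  ... | inj₂ eq = eq
  ... | inj₁ lt = ⊥-elim (<⇒≢ (+-mono-<-≤ lt tails≤) Σa≡Σb)
  tails≡ : sumFin n (λ i → a (suc i)) ≡ sumFin n (λ i → b (suc i))
  tails≡ = +-cancelˡ-≡ (a zero) _ _ (trans Σa≡Σb (cong (_+ _) (sym head≡)))
  pointwise : ∀ i → a i ≡ b i
  pointwise zero    = head≡
  pointwise (suc i) = sumFin-≤-≡⇒≡ n (λ j → a≤b (suc j)) tails≡ i

prodFin-cong : ∀ n {a b : Fin n → ℕ} → (∀ i → a i ≡ b i) → prodFin n a ≡ prodFin n b
prodFin-cong zero    e = refl
prodFin-cong (suc n) e = cong₂ _*_ (e zero) (prodFin-cong n (λ i → e (suc i)))

prodFin-const1 : ∀ n → prodFin n (λ _ → 1) ≡ 1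
prodFin-const1 zero    = refl
prodFin-const1 (suc n) = cong (_+ 0) (prodFin-const1 n)

prodFin-update : ∀ n (r : Fin n) (g h : Fin n → ℕ) (c : ℕ) →
                 (∀ s → s ≢ r → g s ≡ h s) → g r ≡ c * h r → prodFin n g ≡ c * prodFin n h
prodFin-update (suc n) zero g h c off at
  rewrite at | prodFin-cong n {λ i → g (suc i)} {λ i → h (suc i)} (λ i → off (suc i) (λ ())) = *-assoc c (h zero) _
prodFin-update (suc n) (suc r) g h c off at = begin
  g zero * prodFin n (λ i → g (suc i))   ≡⟨ cong₂ _*_ (off zero (λ ())) rest ⟩
  h zero * (c * H)                       ≡⟨ *-assoc (h zero) c H ⟨
  h zero * c * H                         ≡⟨ cong (_* H) (*-comm (h zero) c) ⟩
  c * h zero * H                         ≡⟨ *-assoc c (h zero) H ⟩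
  c * (h zero * H)                       ∎
  where
  open ≡-Reasoning
  H = prodFin n (λ i → h (suc i))
  rest : prodFin n (λ i → g (suc i)) ≡ c * H
  rest = prodFin-update n r (λ i → g (suc i)) (λ i → h (suc i)) c
           (λ s s≢r → off (suc s) (λ eq → s≢r (Fin.suc-injective eq))) at

-- fallingFactorial c o = c (c - 1) ⋯ (c - o + 1), the number of injections [o] → [c].
fallingFactorial : ℕ → ℕ → ℕ
fallingFactorial c       zero    = 1
fallingFactorial zero    (suc o) = 0
fallingFactorial (suc c) (suc o) = suc c * fallingFactorial c o

fallingFactorial-suc : ∀ c o → fallingFactorial c (suc o) ≡ c * fallingFactorial (c ∸ 1) o
fallingFactorial-suc zero    o = refl
fallingFactorial-suc (suc c) o = refl

fallingFactorial-diag : ∀ c → fallingFactorial c c ≡ c !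
fallingFactorial-diag zero    = refl
fallingFactorial-diag (suc c) = cong (suc c *_) (fallingFactorial-diag c)

fallingFactorial-< : ∀ {c o} → c < o → fallingFactorial c o ≡ 0
fallingFactorial-< {zero}  {suc o} _         = refl
fallingFactorial-< {suc c} {suc o} (s≤s c<o) rewrite fallingFactorial-< c<o = *-zeroʳ (suc c)

-- If Σ b = Σ a, then either b = a (and the product is Π a!) or some b s > a s (and it vanishes).
prodFin-fallingFactorial : ∀ m (a b : Fin m → ℕ) → sumFin m b ≡ sumFin m a →
  prodFin m (λ s → fallingFactorial (a s) (b s))
    ≡ (if all (λ s → ℕ==ᵇ (b s) (a s)) (allFin m) then prodFin m (λ s → a s !) else 0)
prodFin-fallingFactorial m a b Σb≡Σa with all (λ s → ℕ==ᵇ (b s) (a s)) (allFin m) in eq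
... | true = prodFin-cong m λ s →
  trans (cong (fallingFactorial (a s)) (Equivalence.to (T-ℕ==ᵇ (b s) (a s)) (b≡a s))) (fallingFactorial-diag (a s))
  where
  b≡a : ∀ s → T (ℕ==ᵇ (b s) (a s))
  b≡a = Equivalence.to (T-all-allFin _) (subst T (sym eq) tt)
... | false with Fin.all? (λ s → b s ≤? a s)
...   | yes b≤a = ⊥-elim (subst T eq (Equivalence.from (T-all-allFin _)
                    (λ s → Equivalence.from (T-ℕ==ᵇ _ _) (sumFin-≤-≡⇒≡ m b≤a Σb≡Σa s))))
...   | no b≰a with Fin.¬∀⟶∃¬ m (λ s → b s ≤ a s) (λ s → b s ≤? a s) b≰a
...     | s , b≰aₛ = prodFin-update m s g g 0 (λ _ _ → refl) (fallingFactorial-< (≰⇒> b≰aₛ))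
  where g = λ s → fallingFactorial (a s) (b s)

count-≟-allFin : ∀ {n} (x : Fin n) → count (λ y → ⌊ x ≟ y ⌋) (allFin n) ≡ 1
count-≟-allFin x = trans (count-tabulate (λ y → ⌊ x ≟ y ⌋) (λ i → i)) (sumFin-indicator x)

count-∧-≟-allFin : ∀ {N} (q : Fin N → Bool) (x : Fin N) →
                   count (λ y → q y ∧ ⌊ x ≟ y ⌋) (allFin N) ≡ ⟦ q x ⟧
count-∧-≟-allFin {N} q x = begin
  count (λ y → q y ∧ ⌊ x ≟ y ⌋) (allFin N)                   ≡⟨ count-cong at-x (allFin N) ⟩
  count (λ y → q x ∧ ⌊ x ≟ y ⌋) (allFin N)                   ≡⟨ count-∧ˡ (q x) _ (allFin N) ⟩
  (if q x then count (λ y → ⌊ x ≟ y ⌋) (allFin N) else 0)   ≡⟨ cong (if q x then_else 0) (count-≟-allFin x) ⟩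
  (if q x then 1 else 0)                                     ≡⟨ lemma (q x) ⟩
  ⟦ q x ⟧                                                    ∎
  where
  open ≡-Reasoning
  at-x : ∀ y → q y ∧ ⌊ x ≟ y ⌋ ≡ q x ∧ ⌊ x ≟ y ⌋
  at-x y with x ≟ y
  ... | yes refl = refl
  ... | no _     = trans (∧-zeroʳ (q y)) (sym (∧-zeroʳ (q x)))
  lemma : ∀ b → (if b then 1 else 0) ≡ ⟦ b ⟧
  lemma true  = refl
  lemma false = refl

count-fibres : (_≟ᴮ_ : DecidableEquality B) (p : A → Bool) (φ : A → B) (xs : List A) (ws : List B) →
               (∀ u → count (λ w → ⌊ u ≟ᴮ w ⌋) ws ≡ 1) →
               count p xs ≡ sumList (λ w → count (λ x → p x ∧ ⌊ φ x ≟ᴮ w ⌋) xs) ws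
count-fibres _≟ᴮ_ p φ []       ws once = sym (sumList-zero ws)
count-fibres _≟ᴮ_ p φ (x ∷ xs) ws once = begin
  count p (x ∷ xs)
    ≡⟨ count-∷ p x xs ⟩
  ⟦ p x ⟧ + count p xs
    ≡⟨ cong₂ _+_ head (count-fibres _≟ᴮ_ p φ xs ws once) ⟩
  sumList (λ w → ⟦ p x ∧ ⌊ φ x ≟ᴮ w ⌋ ⟧) ws
    + sumList (λ w → count (λ y → p y ∧ ⌊ φ y ≟ᴮ w ⌋) xs) ws
    ≡⟨ sumList-+ _ _ ws ⟨
  sumList (λ w → ⟦ p x ∧ ⌊ φ x ≟ᴮ w ⌋ ⟧ + count (λ y → p y ∧ ⌊ φ y ≟ᴮ w ⌋) xs) ws
    ≡⟨ sumList-cong (λ w → count-∷ (λ y → p y ∧ ⌊ φ y ≟ᴮ w ⌋) x xs) ws ⟨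
  sumList (λ w → count (λ y → p y ∧ ⌊ φ y ≟ᴮ w ⌋) (x ∷ xs)) ws ∎
  where
  open ≡-Reasoning
  head : ⟦ p x ⟧ ≡ sumList (λ w → ⟦ p x ∧ ⌊ φ x ≟ᴮ w ⌋ ⟧) ws
  head with p x
  ... | true  = sym (trans (sumList-⟦⟧ (λ w → ⌊ φ x ≟ᴮ w ⌋) ws) (once (φ x)))
  ... | false = sym (sumList-zero ws)

⌊≡-dec⌋-∷ : (_≟ᴬ_ : DecidableEquality A) {n : ℕ} (x y : A) (u v : Vec A n) →
            ⌊ Vec.≡-dec _≟ᴬ_ (x ∷ u) (y ∷ v) ⌋ ≡ ⌊ x ≟ᴬ y ⌋ ∧ ⌊ Vec.≡-dec _≟ᴬ_ u v ⌋
⌊≡-dec⌋-∷ _≟ᴬ_ x y u v =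
  trans (isYes≗does _) (sym (cong₂ _∧_ (isYes≗does (x ≟ᴬ y)) (isYes≗does (Vec.≡-dec _≟ᴬ_ u v))))

count-≟-allVecs : (_≟ᴬ_ : DecidableEquality A) (xs : List A) →
                  (∀ a → count (λ x → ⌊ a ≟ᴬ x ⌋) xs ≡ 1) →
                  ∀ n (u : Vec A n) → count (λ v → ⌊ Vec.≡-dec _≟ᴬ_ u v ⌋) (allVecs xs n) ≡ 1
count-≟-allVecs _≟ᴬ_ xs once zero    []      = refl
count-≟-allVecs _≟ᴬ_ xs once (suc n) (a ∷ u) = begin
  count (λ v → ⌊ (a ∷ u) ≟ᴬⁿ v ⌋) (allVecs xs (suc n))
    ≡⟨ count-allVecs-suc (λ v → ⌊ (a ∷ u) ≟ᴬⁿ v ⌋) xs ⟩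
  sumList (λ x → count (λ v → ⌊ (a ∷ u) ≟ᴬⁿ (x ∷ v) ⌋) (allVecs xs n)) xs
    ≡⟨ sumList-cong (λ x → trans (count-cong (⌊≡-dec⌋-∷ _≟ᴬ_ a x u) (allVecs xs n))
                                 (count-∧ˡ ⌊ a ≟ᴬ x ⌋ _ (allVecs xs n))) xs ⟩
  sumList (λ x → if ⌊ a ≟ᴬ x ⌋ then count (λ v → ⌊ u ≟ᴬⁿ v ⌋) (allVecs xs n) else 0) xs
    ≡⟨ sumList-if _ _ 1 (λ _ _ → count-≟-allVecs _≟ᴬ_ xs once n u) xs ⟩
  count (λ x → ⌊ a ≟ᴬ x ⌋) xs * 1
    ≡⟨ cong (_* 1) (once a) ⟩
  1 ∎
  where
  open ≡-Reasoning
  _≟ᴬⁿ_ : ∀ {n} → DecidableEquality (Vec _ n)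
  _≟ᴬⁿ_ = Vec.≡-dec _≟ᴬ_

delete : ∀ {N} → (Fin N → Bool) → Fin N → (Fin N → Bool)
delete S x y = S y ∧ not ⌊ x ≟ y ⌋

distinctIn : ∀ {N n} → (Fin N → Bool) → Vec (Fin N) n → Bool
distinctIn S []      = true
distinctIn S (x ∷ v) = S x ∧ distinctIn (delete S x) v

distinctIn⇔occ≤ : ∀ {N n} (S : Fin N → Bool) (v : Vec (Fin N) n) →
                  T (distinctIn S v) ⇔ (∀ y → occ v y ≤ ⟦ S y ⟧)
distinctIn⇔occ≤ S []      = mk⇔ (λ _ _ → z≤n) (λ _ → tt)
distinctIn⇔occ≤ S (x ∷ v) = mk⇔ to from
  where
  rest = distinctIn⇔occ≤ (delete S x) v
  occ-∷ : ∀ y → occ (x ∷ v) y ≡ ⟦ ⌊ x ≟ y ⌋ ⟧ + occ v y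
  occ-∷ y = count-∷ (λ z → ⌊ z ≟ y ⌋) x (toList v)
  -- y occurs at the head only if y = x, and x must lie in S but not in the tail's alphabet.
  step : ∀ a s o → ⟦ a ⟧ + o ≤ ⟦ s ⟧ ⇔ ((T a → T s) × o ≤ ⟦ s ∧ not a ⟧)
  step true  true  o = mk⇔ (λ { (s≤s o≤0) → (λ _ → tt) , o≤0 }) (λ (_ , o≤0) → s≤s o≤0)
  step true  false o = mk⇔ (λ ()) (λ (a⇒s , _) → ⊥-elim (a⇒s tt))
  step false true  o = mk⇔ (λ o≤1 → (λ ()) , o≤1) proj₂
  step false false o = mk⇔ (λ o≤0 → (λ ()) , o≤0) proj₂
  to : T (distinctIn S (x ∷ v)) → ∀ y → occ (x ∷ v) y ≤ ⟦ S y ⟧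
  to t y = subst (_≤ ⟦ S y ⟧) (sym (occ-∷ y)) (Equivalence.from (step ⌊ x ≟ y ⌋ (S y) (occ v y))
             ((λ x≟y → subst (T ∘ S) (toWitness x≟y) Sx) , Equivalence.to rest tail y))
    where
    Sx = proj₁ (Equivalence.to T-∧ t)
    tail = proj₂ (Equivalence.to (T-∧ {S x}) t)
  from : (∀ y → occ (x ∷ v) y ≤ ⟦ S y ⟧) → T (distinctIn S (x ∷ v))
  from h = Equivalence.from T-∧ (proj₁ (split x) (fromWitness refl) , Equivalence.from rest (proj₂ ∘ split))
    where
    split : ∀ y → (T ⌊ x ≟ y ⌋ → T (S y)) × occ v y ≤ ⟦ S y ∧ not ⌊ x ≟ y ⌋ ⟧
    split y = Equivalence.to (step _ _ _) (subst (_≤ ⟦ S y ⟧) (occ-∷ y) (h y))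

distinctIn-head≢ : ∀ {N n} (S : Fin N → Bool) (x y : Fin N) (v : Vec (Fin N) n) →
                   T (distinctIn S (x ∷ y ∷ v)) → x ≢ y
distinctIn-head≢ S x y v t refl = T-not y∉S∖x (fromWitness refl)
  where
  y∈S∖x = proj₁ (Equivalence.to (T-∧ {delete S x y}) (proj₂ (Equivalence.to (T-∧ {S x}) t)))
  y∉S∖x = proj₂ (Equivalence.to (T-∧ {S y}) y∈S∖x)

sumFin-occ : ∀ {N n} (v : Vec (Fin N) n) → sumFin N (occ v) ≡ n
sumFin-occ v = trans (sumFin-count (λ x → x) (toList v)) (Vec.length-toList v)

-- Pigeonhole: for a word of length N over Fin N, surjective and injective both mean every letter occurs once.
isPerm≡distinctIn : ∀ N (v : Vec (Fin N) N) → isPerm N v ≡ distinctIn (λ _ → true) v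
isPerm≡distinctIn N v = T-injective (mk⇔
  (λ t → Equivalence.from distinct (≤-reflexive ∘ sym ∘ once≤ (Equivalence.to surjective t)))
  (λ t → Equivalence.from surjective (≤-reflexive ∘ sym ∘ ≤once (Equivalence.to distinct t))))
  where
  surjective : T (isPerm N v) ⇔ (∀ j → 1 ≤ occ v j)
  surjective = mk⇔
    (λ t j → Equivalence.to (T-any⇔1≤count _ (toList v)) (Equivalence.to (T-all-allFin _) t j))
    (λ h → Equivalence.from (T-all-allFin _) (λ j → Equivalence.from (T-any⇔1≤count _ (toList v)) (h j)))
  distinct = distinctIn⇔occ≤ (λ _ → true) v
  Σ1≡Σocc : sumFin N (λ _ → 1) ≡ sumFin N (occ v)
  Σ1≡Σocc = trans (trans (sumFin-const N 1) (*-identityʳ N)) (sym (sumFin-occ v))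
  once≤ : (∀ j → 1 ≤ occ v j) → ∀ j → 1 ≡ occ v j
  once≤ h = sumFin-≤-≡⇒≡ N h Σ1≡Σocc
  ≤once : (∀ j → occ v j ≤ 1) → ∀ j → occ v j ≡ 1
  ≤once h = sumFin-≤-≡⇒≡ N h (sym Σ1≡Σocc)

descents : ∀ {n} → (A → A → Bool) → Vec A (suc n) → Vec Bool n
descents R v = Vec.tabulate (λ i → R (lookup v (inject₁ i)) (lookup v (suc i)))

_≟ⱽ_ : ∀ {m n} → DecidableEquality (Vec (Fin m) n)
_≟ⱽ_ = Vec.≡-dec _≟_

module Colouring {m N : ℕ} (colour : Fin N → Fin m) where

  colourCount : (Fin N → Bool) → Fin m → ℕ
  colourCount S s = count (λ y → S y ∧ ⌊ colour y ≟ s ⌋) (allFin N)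

  colourCount-delete : ∀ S x s → T (S x) →
                       colourCount S s ≡ ⟦ ⌊ colour x ≟ s ⌋ ⟧ + colourCount (delete S x) s
  colourCount-delete S x s Sx = begin
    colourCount S s
      ≡⟨ count-split (λ y → S y ∧ ⌊ colour y ≟ s ⌋) (λ y → ⌊ x ≟ y ⌋) (allFin N) ⟩
    count (λ y → (S y ∧ ⌊ colour y ≟ s ⌋) ∧ ⌊ x ≟ y ⌋) (allFin N)
      + count (λ y → (S y ∧ ⌊ colour y ≟ s ⌋) ∧ not ⌊ x ≟ y ⌋) (allFin N)
      ≡⟨ cong₂ _+_ (count-∧-≟-allFin (λ y → S y ∧ ⌊ colour y ≟ s ⌋) x)
                   (count-cong (λ y → ∧-Semigroup.xy∙z≈xz∙y (S y) _ _) (allFin N)) ⟩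
    ⟦ S x ∧ ⌊ colour x ≟ s ⌋ ⟧ + colourCount (delete S x) s
      ≡⟨ cong (λ b → ⟦ b ∧ ⌊ colour x ≟ s ⌋ ⟧ + colourCount (delete S x) s) (Equivalence.to T-≡ Sx) ⟩
    ⟦ ⌊ colour x ≟ s ⌋ ⟧ + colourCount (delete S x) s ∎
    where open ≡-Reasoning

  fibre : ∀ {n} → (Fin N → Bool) → Vec (Fin m) n → ℕ
  fibre {n} S w = count (λ v → distinctIn S v ∧ ⌊ Vec.map colour v ≟ⱽ w ⌋) (allVecs (allFin N) n)

  -- The head of v is one of the colourCount S r letters of S coloured r, and the tail is a word
  -- in the alphabet with that letter deleted, which has one letter of colour r fewer.
  fibre-formula : ∀ {n} S (w : Vec (Fin m) n) →
                  fibre S w ≡ prodFin m (λ s → fallingFactorial (colourCount S s) (occ w s))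
  fibre-formula S []              = sym (prodFin-const1 m)
  fibre-formula {suc n} S (r ∷ w) = begin
    fibre S (r ∷ w)
      ≡⟨ count-allVecs-suc _ (allFin N) ⟩
    sumList (λ x → count (λ v → (S x ∧ distinctIn (delete S x) v)
                                ∧ ⌊ (colour x ∷ Vec.map colour v) ≟ⱽ (r ∷ w) ⌋) Vs) (allFin N)
      ≡⟨ sumList-cong (λ x → trans (count-cong (regroup x) Vs)
                                   (count-∧ˡ (S x ∧ ⌊ colour x ≟ r ⌋) _ Vs)) (allFin N) ⟩
    sumList (λ x → if S x ∧ ⌊ colour x ≟ r ⌋ then fibre (delete S x) w else 0) (allFin N)
      ≡⟨ sumList-if _ _ (prodFin m tailTerm) fibre-tail (allFin N) ⟩
    colourCount S r * prodFin m tailTerm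
      ≡⟨ prodFin-update m r term tailTerm (colourCount S r) off at ⟨
    prodFin m term ∎
    where
    open ≡-Reasoning
    Vs = allVecs (allFin N) n
    term tailTerm : Fin m → ℕ
    term s     = fallingFactorial (colourCount S s) (occ (r ∷ w) s)
    tailTerm s = fallingFactorial (colourCount S s ∸ ⟦ ⌊ r ≟ s ⌋ ⟧) (occ w s)
    regroup : ∀ x v → (S x ∧ distinctIn (delete S x) v) ∧ ⌊ (colour x ∷ Vec.map colour v) ≟ⱽ (r ∷ w) ⌋
                      ≡ (S x ∧ ⌊ colour x ≟ r ⌋) ∧ (distinctIn (delete S x) v ∧ ⌊ Vec.map colour v ≟ⱽ w ⌋)
    regroup x v = trans (cong (_ ∧_) (⌊≡-dec⌋-∷ _≟_ (colour x) r _ w))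
                        (∧-Semigroup.interchange (S x) (distinctIn (delete S x) v) _ _)
    fibre-tail : ∀ x → T (S x ∧ ⌊ colour x ≟ r ⌋) → fibre (delete S x) w ≡ prodFin m tailTerm
    fibre-tail x t = trans (fibre-formula (delete S x) w)
                           (prodFin-cong m λ s → cong (λ c → fallingFactorial c (occ w s)) (count-deleted s))
      where
      Sx = proj₁ (Equivalence.to (T-∧ {S x}) t)
      colour-x≡r = toWitness (proj₂ (Equivalence.to (T-∧ {S x}) t))
      count-deleted : ∀ s → colourCount (delete S x) s ≡ colourCount S s ∸ ⟦ ⌊ r ≟ s ⌋ ⟧
      count-deleted s = sym (begin
        colourCount S s ∸ ⟦ ⌊ r ≟ s ⌋ ⟧
          ≡⟨ cong (_∸ ⟦ ⌊ r ≟ s ⌋ ⟧) (colourCount-delete S x s Sx) ⟩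
        ⟦ ⌊ colour x ≟ s ⌋ ⟧ + colourCount (delete S x) s ∸ ⟦ ⌊ r ≟ s ⌋ ⟧
          ≡⟨ cong (λ c → ⟦ ⌊ c ≟ s ⌋ ⟧ + colourCount (delete S x) s ∸ ⟦ ⌊ r ≟ s ⌋ ⟧) colour-x≡r ⟩
        ⟦ ⌊ r ≟ s ⌋ ⟧ + colourCount (delete S x) s ∸ ⟦ ⌊ r ≟ s ⌋ ⟧
          ≡⟨ m+n∸m≡n ⟦ ⌊ r ≟ s ⌋ ⟧ _ ⟩
        colourCount (delete S x) s ∎)
    off : ∀ s → s ≢ r → term s ≡ tailTerm s
    off s s≢r with r ≟ s
    ... | yes r≡s = ⊥-elim (s≢r (sym r≡s))
    ... | no _    = refl
    at : term r ≡ colourCount S r * tailTerm r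
    at with r ≟ r
    ... | yes _  = fallingFactorial-suc (colourCount S r) (occ w r)
    ... | no r≢r = ⊥-elim (r≢r refl)

  descents-map-colour : (R : Fin N → Fin N → Bool) (Q : Fin m → Fin m → Bool) →
                        (∀ a b → a ≢ b → R a b ≡ Q (colour a) (colour b)) →
                        ∀ {n} S (v : Vec (Fin N) (suc n)) → T (distinctIn S v) →
                        descents R v ≡ descents Q (Vec.map colour v)
  descents-map-colour R Q R≡Q S (x ∷ [])    _ = refl
  descents-map-colour R Q R≡Q S (x ∷ y ∷ v) t =
    cong₂ _∷_ (R≡Q x y (distinctIn-head≢ S x y v t))
              (descents-map-colour R Q R≡Q (delete S x) (y ∷ v) (proj₂ (Equivalence.to (T-∧ {S x}) t)))

module Periodic (m : ℕ) .{{_ : NonZero m}} (X : ℕ → ℕ → Bool) (f : Fin m → Fin m → Bool)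
                (periodic : ∀ a b → a ≢ b → X a b ≡ f (a mod m) (b mod m)) (k : ℕ) where

  N : ℕ
  N = suc k

  -- The letter y : Fin N stands for the value y + 1 ∈ [N].
  residue : Fin N → Fin m
  residue y = suc (toℕ y) mod m

  open Colouring residue public

  allLetters : Fin N → Bool
  allLetters _ = true

  ∏ℓ! : ℕ
  ∏ℓ! = prodFin m (λ r → ell m N r !)

  content : Vec (Fin m) N → Bool
  content w = all (λ r → ℕ==ᵇ (occ w r) (ell m N r)) (allFin m)

  XDes≡descents : ∀ v → T (distinctIn allLetters v) → XDes X k v ≡ descents f (Vec.map residue v)
  XDes≡descents = descents-map-colour _ f
    (λ a b a≢b → periodic _ _ (λ eq → a≢b (Fin.toℕ-injective (suc-injective eq)))) allLetters

  colourCount≡ell : ∀ s → colourCount allLetters s ≡ ell m N s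
  colourCount≡ell s = begin
    count (λ y → ⌊ residue y ≟ s ⌋) (allFin N)
      ≡⟨ count-tabulate (λ y → ⌊ residue y ≟ s ⌋) (λ y → y) ⟩
    sumFin N (λ i → ⟦ ⌊ residue i ≟ s ⌋ ⟧)
      ≡⟨ count-tabulate (λ t → ⌊ t mod m ≟ s ⌋) (λ (i : Fin N) → suc (toℕ i)) ⟨
    count (λ t → ⌊ t mod m ≟ s ⌋) (tabulate (λ (i : Fin N) → suc (toℕ i)))
      ≡⟨ cong (count _) (trans (cong (map suc) (applyUpTo≡tabulate (λ t → t) N)) (map-tabulate toℕ suc)) ⟨
    ell m N s ∎
    where open ≡-Reasoning

  fibre-all : ∀ w → fibre allLetters w ≡ (if content w then ∏ℓ! else 0)
  fibre-all w = begin
    fibre allLetters w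
      ≡⟨ fibre-formula allLetters w ⟩
    prodFin m (λ s → fallingFactorial (colourCount allLetters s) (occ w s))
      ≡⟨ prodFin-cong m (λ s → cong (λ c → fallingFactorial c (occ w s)) (colourCount≡ell s)) ⟩
    prodFin m (λ s → fallingFactorial (ell m N s) (occ w s))
      ≡⟨ prodFin-fallingFactorial m (ell m N) (occ w) (trans (sumFin-occ w) (sym Σell≡N)) ⟩
    (if content w then ∏ℓ! else 0) ∎
    where
    open ≡-Reasoning
    Σell≡N : sumFin m (ell m N) ≡ N
    Σell≡N = trans (sym (sumFin-cong m colourCount≡ell))
                   (trans (sumFin-count residue (allFin N)) (length-tabulate (λ y → y)))

  fibre-descents : ∀ I w →
    count (λ v → (distinctIn allLetters v ∧ eqVecBool (XDes X k v) I) ∧ ⌊ Vec.map residue v ≟ⱽ w ⌋)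
          (allVecs (allFin N) N)
      ≡ (if inW m f k I w then ∏ℓ! else 0)
  fibre-descents I w = begin
    count (λ v → (distinctIn allLetters v ∧ eqVecBool (XDes X k v) I) ∧ ⌊ Vec.map residue v ≟ⱽ w ⌋) Vs
      ≡⟨ count-cong regroup Vs ⟩
    count (λ v → eqVecBool (descents f w) I ∧ (distinctIn allLetters v ∧ ⌊ Vec.map residue v ≟ⱽ w ⌋)) Vs
      ≡⟨ count-∧ˡ (eqVecBool (descents f w) I) _ Vs ⟩
    (if eqVecBool (descents f w) I then fibre allLetters w else 0)
      ≡⟨ cong (if eqVecBool (descents f w) I then_else 0) (fibre-all w) ⟩
    (if eqVecBool (descents f w) I then (if content w then ∏ℓ! else 0) else 0)
      ≡⟨ if-∧ (content w) (eqVecBool (descents f w) I) ∏ℓ! ⟩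
    (if inW m f k I w then ∏ℓ! else 0) ∎
    where
    open ≡-Reasoning
    Vs = allVecs (allFin N) N
    regroup : ∀ v → (distinctIn allLetters v ∧ eqVecBool (XDes X k v) I) ∧ ⌊ Vec.map residue v ≟ⱽ w ⌋
                    ≡ eqVecBool (descents f w) I ∧ (distinctIn allLetters v ∧ ⌊ Vec.map residue v ≟ⱽ w ⌋)
    regroup v with distinctIn allLetters v in distinct | Vec.map residue v ≟ⱽ w
    ... | false | _         = sym (∧-zeroʳ _)
    ... | true  | no _      = trans (∧-zeroʳ _) (sym (∧-zeroʳ _))
    ... | true  | yes refl  = trans (∧-identityʳ _) (trans
          (cong (λ d → eqVecBool d I) (XDes≡descents v (subst T (sym distinct) tt))) (sym (∧-identityʳ _)))

theorem2p5 : (m : ℕ) .{{_ : NonZero m}} (X : ℕ → ℕ → Bool) (f : Fin m → Fin m → Bool)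
    → (∀ a b → a ≢ b → X a b ≡ f (a mod m) (b mod m))
    → (k : ℕ) (I : Vec Bool k)
    → dX X k I ≡ cardW m f k I * prodFin m (λ r → ell m (suc k) r !)
theorem2p5 m X f periodic k I = begin
  dX X k I
    ≡⟨ count-cong (λ v → cong (_∧ eqVecBool (XDes X k v) I) (isPerm≡distinctIn N v)) Vs ⟩
  count isXPerm Vs
    ≡⟨ count-fibres _≟ⱽ_ isXPerm (Vec.map residue) Vs Ws (count-≟-allVecs _≟_ (allFin m) count-≟-allFin N) ⟩
  sumList (λ w → count (λ v → isXPerm v ∧ ⌊ Vec.map residue v ≟ⱽ w ⌋) Vs) Ws
    ≡⟨ sumList-cong (fibre-descents I) Ws ⟩
  sumList (λ w → if inW m f k I w then ∏ℓ! else 0) Ws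
    ≡⟨ sumList-if (inW m f k I) (λ _ → ∏ℓ!) ∏ℓ! (λ _ _ → refl) Ws ⟩
  cardW m f k I * ∏ℓ! ∎
  where
  open ≡-Reasoning
  open Periodic m X f periodic k
  Vs = allVecs (allFin N) N
  Ws = allVecs (allFin m) N
  isXPerm : Vec (Fin N) N → Bool
  isXPerm v = distinctIn allLetters v ∧ eqVecBool (XDes X k v) I
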